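{- None of the following rooted multigraphs has a positive semidefinite associated matrix (where a vertex described as "arbitrary" may or may not be a root, and the claim holds for every such choice): (1) two vertices $u,v$ joined by an edge of multiplicity $2$, with $u$ a root and $v$ arbitrary; (2) two non-root vertices joined by an edge of multiplicity $3$; (3) a path $u$–$v$–$w$ on three vertices with simple edges, all three vertices roots; (4) vertices $a,b,c$ with an edge of multiplicity $2$ between $a$ and $b$ and a simple edge $bc$ (no edge $ac$), where $b$ is a non-root and $a,c$ are arbitrary; (5) vertices $a,b,c$ with edges of multiplicity $2$ between $a$ and $b$ and between $b$ and $c$, and a simple edge $ac$, with $a,b,c$ arbitrary; (6) a path $a$–$b$–$c$–$d$ with simple edges, where $b$ is a root, $c$ is a non-root, and $a,d$ are arbitrary; (7) a $4$-cycle $a$–$b$–$c$–$d$–$a$ with simple edges, where $b$ is a root, $c,d$ are non-roots, and $a$ is arbitrary.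
   Context: A rooted multigraph $G_R$ is a loopless multigraph $G$ with a distinguished subset $R\subseteq V(G)$ of roots. Its associated matrix is $A_G+2I$, where $A_G$ is the adjacency matrix recording edge multiplicities, except that the diagonal entries corresponding to vertices in $R$ equal $1$ instead of $2$. -}

module Defs where

open import Data.Nat using (ℕ; zero; suc)
open import Data.Bool using (Bool; true; false; if_then_else_)
open import Data.Fin using (Fin; zero; suc)
open import Data.Fin.Properties using (_≟_)
open import Data.Integer as ℤ using (ℤ; +_)
open import Data.Rational as ℚ using (ℚ; 0ℚ; _/_)
open import Relation.Binary.PropositionalEquality using (_≡_; refl)
open import Relation.Nullary.Decidable using (⌊_⌋)

record Multigraph (n : ℕ) : Set where
  field
    mult     : Fin n → Fin n → ℕ
    sym      : ∀ i j → mult i j ≡ mult j i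
    loopless : ∀ i → mult i i ≡ 0
open Multigraph public

Roots : ℕ → Set
Roots n = Fin n → Bool

adjMatrix : ∀ {n} → Multigraph n → Fin n → Fin n → ℤ
adjMatrix G i j = + mult G i j

assocMatrix : ∀ {n} → Multigraph n → Roots n → Fin n → Fin n → ℤ
assocMatrix G R i j =
  adjMatrix G i j ℤ.+ (if ⌊ i ≟ j ⌋ then (if R i then + 1 else + 2) else + 0)

∑ : ∀ {n} → (Fin n → ℚ) → ℚ
∑ {zero}  f = 0ℚ
∑ {suc n} f = f zero ℚ.+ ∑ (λ i → f (suc i))

quadForm : ∀ {n} → (Fin n → Fin n → ℤ) → (Fin n → ℚ) → ℚ
quadForm M x = ∑ (λ i → ∑ (λ j → x i ℚ.* ((M i j / 1) ℚ.* x j)))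

PSD : ∀ {n} → (Fin n → Fin n → ℤ) → Set
PSD M = ∀ x → 0ℚ ℚ.≤ quadForm M x

-- The seven multigraphs.  Vertices: Fin 2 = u,v ; Fin 3 = a,b,c ;
-- Fin 4 = a,b,c,d (in this order).

m1 : Fin 2 → Fin 2 → ℕ
m1 zero (suc zero) = 2
m1 (suc zero) zero = 2
m1 _ _ = 0

G1 : Multigraph 2
G1 = record { mult = m1 ; sym = s ; loopless = l }
  where
  s : ∀ i j → m1 i j ≡ m1 j i
  s zero zero = refl
  s zero (suc zero) = refl
  s (suc zero) zero = refl
  s (suc zero) (suc zero) = refl
  l : ∀ i → m1 i i ≡ 0
  l zero = refl
  l (suc zero) = refl

m2 : Fin 2 → Fin 2 → ℕ
m2 zero (suc zero) = 3
m2 (suc zero) zero = 3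
m2 _ _ = 0

G2 : Multigraph 2
G2 = record { mult = m2 ; sym = s ; loopless = l }
  where
  s : ∀ i j → m2 i j ≡ m2 j i
  s zero zero = refl
  s zero (suc zero) = refl
  s (suc zero) zero = refl
  s (suc zero) (suc zero) = refl
  l : ∀ i → m2 i i ≡ 0
  l zero = refl
  l (suc zero) = refl


m3 : Fin 3 → Fin 3 → ℕ
m3 zero (suc zero) = 1
m3 (suc zero) zero = 1
m3 (suc zero) (suc (suc zero)) = 1
m3 (suc (suc zero)) (suc zero) = 1
m3 _ _ = 0

m4 : Fin 3 → Fin 3 → ℕ
m4 zero (suc zero) = 2
m4 (suc zero) zero = 2
m4 (suc zero) (suc (suc zero)) = 1
m4 (suc (suc zero)) (suc zero) = 1
m4 _ _ = 0

m5 : Fin 3 → Fin 3 → ℕ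
m5 zero (suc zero) = 2
m5 (suc zero) zero = 2
m5 (suc zero) (suc (suc zero)) = 2
m5 (suc (suc zero)) (suc zero) = 2
m5 zero (suc (suc zero)) = 1
m5 (suc (suc zero)) zero = 1
m5 _ _ = 0

all3sym : (m : Fin 3 → Fin 3 → ℕ) →
  m zero (suc zero) ≡ m (suc zero) zero →
  m zero (suc (suc zero)) ≡ m (suc (suc zero)) zero →
  m (suc zero) (suc (suc zero)) ≡ m (suc (suc zero)) (suc zero) →
  ∀ i j → m i j ≡ m j i
all3sym m p q r zero zero = refl
all3sym m p q r zero (suc zero) = p
all3sym m p q r zero (suc (suc zero)) = q
all3sym m p q r (suc zero) zero = Relation.Binary.PropositionalEquality.sym p
all3sym m p q r (suc zero) (suc zero) = refl
all3sym m p q r (suc zero) (suc (suc zero)) = r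
all3sym m p q r (suc (suc zero)) zero = Relation.Binary.PropositionalEquality.sym q
all3sym m p q r (suc (suc zero)) (suc zero) = Relation.Binary.PropositionalEquality.sym r
all3sym m p q r (suc (suc zero)) (suc (suc zero)) = refl

all3loop : (m : Fin 3 → Fin 3 → ℕ) →
  m zero zero ≡ 0 → m (suc zero) (suc zero) ≡ 0 →
  m (suc (suc zero)) (suc (suc zero)) ≡ 0 → ∀ i → m i i ≡ 0
all3loop m p q r zero = p
all3loop m p q r (suc zero) = q
all3loop m p q r (suc (suc zero)) = r

G3 : Multigraph 3
G3 = record { mult = m3 ; sym = all3sym m3 refl refl refl
            ; loopless = all3loop m3 refl refl refl }

G4 : Multigraph 3
G4 = record { mult = m4 ; sym = all3sym m4 refl refl refl
            ; loopless = all3loop m4 refl refl refl }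

G5 : Multigraph 3
G5 = record { mult = m5 ; sym = all3sym m5 refl refl refl
            ; loopless = all3loop m5 refl refl refl }

a₄ b₄ c₄ d₄ : Fin 4
a₄ = zero
b₄ = suc zero
c₄ = suc (suc zero)
d₄ = suc (suc (suc zero))

m6 : Fin 4 → Fin 4 → ℕ
m6 zero (suc zero) = 1
m6 (suc zero) zero = 1
m6 (suc zero) (suc (suc zero)) = 1
m6 (suc (suc zero)) (suc zero) = 1
m6 (suc (suc zero)) (suc (suc (suc zero))) = 1
m6 (suc (suc (suc zero))) (suc (suc zero)) = 1
m6 _ _ = 0

m7 : Fin 4 → Fin 4 → ℕ
m7 zero (suc zero) = 1
m7 (suc zero) zero = 1
m7 (suc zero) (suc (suc zero)) = 1
m7 (suc (suc zero)) (suc zero) = 1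
m7 (suc (suc zero)) (suc (suc (suc zero))) = 1
m7 (suc (suc (suc zero))) (suc (suc zero)) = 1
m7 (suc (suc (suc zero))) zero = 1
m7 zero (suc (suc (suc zero))) = 1
m7 _ _ = 0

sym6 : ∀ i j → m6 i j ≡ m6 j i
sym6 zero zero = refl
sym6 zero (suc zero) = refl
sym6 zero (suc (suc zero)) = refl
sym6 zero (suc (suc (suc zero))) = refl
sym6 (suc zero) zero = refl
sym6 (suc zero) (suc zero) = refl
sym6 (suc zero) (suc (suc zero)) = refl
sym6 (suc zero) (suc (suc (suc zero))) = refl
sym6 (suc (suc zero)) zero = refl
sym6 (suc (suc zero)) (suc zero) = refl
sym6 (suc (suc zero)) (suc (suc zero)) = refl
sym6 (suc (suc zero)) (suc (suc (suc zero))) = refl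
sym6 (suc (suc (suc zero))) zero = refl
sym6 (suc (suc (suc zero))) (suc zero) = refl
sym6 (suc (suc (suc zero))) (suc (suc zero)) = refl
sym6 (suc (suc (suc zero))) (suc (suc (suc zero))) = refl

sym7 : ∀ i j → m7 i j ≡ m7 j i
sym7 zero zero = refl
sym7 zero (suc zero) = refl
sym7 zero (suc (suc zero)) = refl
sym7 zero (suc (suc (suc zero))) = refl
sym7 (suc zero) zero = refl
sym7 (suc zero) (suc zero) = refl
sym7 (suc zero) (suc (suc zero)) = refl
sym7 (suc zero) (suc (suc (suc zero))) = refl
sym7 (suc (suc zero)) zero = refl
sym7 (suc (suc zero)) (suc zero) = refl
sym7 (suc (suc zero)) (suc (suc zero)) = refl
sym7 (suc (suc zero)) (suc (suc (suc zero))) = refl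
sym7 (suc (suc (suc zero))) zero = refl
sym7 (suc (suc (suc zero))) (suc zero) = refl
sym7 (suc (suc (suc zero))) (suc (suc zero)) = refl
sym7 (suc (suc (suc zero))) (suc (suc (suc zero))) = refl

loop4 : (m : Fin 4 → Fin 4 → ℕ) → m a₄ a₄ ≡ 0 → m b₄ b₄ ≡ 0 →
  m c₄ c₄ ≡ 0 → m d₄ d₄ ≡ 0 → ∀ i → m i i ≡ 0
loop4 m p q r s zero = p
loop4 m p q r s (suc zero) = q
loop4 m p q r s (suc (suc zero)) = r
loop4 m p q r s (suc (suc (suc zero))) = s

G6 : Multigraph 4
G6 = record { mult = m6 ; sym = sym6 ; loopless = loop4 m6 refl refl refl refl }

G7 : Multigraph 4
G7 = record { mult = m7 ; sym = sym7 ; loopless = loop4 m7 refl refl refl refl }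

{-# OPTIONS --safe #-}
module Submission where

-- Each case is refuted by an explicit integer vector x with xᵀ M x < 0.
-- The diagonal entries of M enter xᵀ M x with the nonnegative weights xᵢ²,
-- so it suffices to find x working when the arbitrary vertices are
-- non-roots (diagonal entry 2); the same x then works for every choice of
-- roots, which is confirmed by evaluation.

open import Defs
open import Data.Bool using (Bool; true; false)
open import Data.Fin using (Fin; zero; suc)
open import Data.Integer using (ℤ; +_; -_)
open import Data.Nat as ℕ using ()
open import Data.Product using (_×_; _,_)
open import Data.Rational as ℚ using (ℚ; 0ℚ)
open import Data.Rational.Properties using (_<?_; <-irrefl; <-≤-trans)
open import Data.Vec using (Vec; []; _∷_; lookup; tabulate)
open import Data.Vec.Properties using (lookup∘tabulate)
open import Function using (_∘_)
open import Relation.Binary.PropositionalEquality as ≡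
  using (_≡_; refl; cong; cong₂; subst)
open import Relation.Nullary using (¬_)
open import Relation.Nullary.Decidable using (True; toWitness)

∑-cong : ∀ {n} {f g : Fin n → ℚ} → (∀ i → f i ≡ g i) → ∑ f ≡ ∑ g
∑-cong {ℕ.zero}  f≗g = refl
∑-cong {ℕ.suc n} f≗g = cong₂ ℚ._+_ (f≗g zero) (∑-cong (f≗g ∘ suc))

quadForm-cong : ∀ {n} {M N : Fin n → Fin n → ℤ} → (∀ i j → M i j ≡ N i j) →
                ∀ x → quadForm M x ≡ quadForm N x
quadForm-cong M≗N x = ∑-cong λ i → ∑-cong λ j →
  cong (λ m → x i ℚ.* ((m ℚ./ 1) ℚ.* x j)) (M≗N i j)

PSD-respects-roots : ∀ {n} (G : Multigraph n) {R R′ : Roots n} →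
                     (∀ i → R i ≡ R′ i) →
                     PSD (assocMatrix G R) → PSD (assocMatrix G R′)
PSD-respects-roots G {R} {R′} R≗R′ psd x =
  subst (0ℚ ℚ.≤_) (quadForm-cong assoc≗ x) (psd x)
  where
  assoc≗ : ∀ i j → assocMatrix G R i j ≡ assocMatrix G R′ i j
  assoc≗ i j rewrite R≗R′ i = refl

-- A root function cannot be split on by pattern matching; its tabulation can.
PSD-tabulate : ∀ {n} (G : Multigraph n) (R : Roots n) →
               PSD (assocMatrix G R) → PSD (assocMatrix G (lookup (tabulate R)))
PSD-tabulate G R = PSD-respects-roots G (≡.sym ∘ lookup∘tabulate R)

¬PSD-witness : ∀ {n} (G : Multigraph n) (rs : Vec Bool n) (x : Vec ℤ n) →
               let M = assocMatrix G (lookup rs); x̂ = λ i → lookup x i ℚ./ 1 in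
               {True (quadForm M x̂ <? 0ℚ)} → ¬ PSD M
¬PSD-witness G rs x {negative} psd =
  <-irrefl refl (<-≤-trans (toWitness negative) (psd (λ i → lookup x i ℚ./ 1)))

-- Above each refutation: xᵀ M x for its witness x, where d(v) ∈ {1, 2} is the
-- diagonal entry of vertex v.

-- d(v) − 4
G1-¬PSD : ∀ rs → lookup rs zero ≡ true → ¬ PSD (assocMatrix G1 (lookup rs))
G1-¬PSD rs@(true ∷ true  ∷ []) refl = ¬PSD-witness G1 rs (+ 2 ∷ - + 1 ∷ [])
G1-¬PSD rs@(true ∷ false ∷ []) refl = ¬PSD-witness G1 rs (+ 2 ∷ - + 1 ∷ [])

-- −2
G2-¬PSD : ∀ rs → lookup rs zero ≡ false → lookup rs (suc zero) ≡ false →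
          ¬ PSD (assocMatrix G2 (lookup rs))
G2-¬PSD rs@(false ∷ false ∷ []) refl refl = ¬PSD-witness G2 rs (+ 1 ∷ - + 1 ∷ [])

-- −1
G3-¬PSD : ∀ rs → lookup rs zero ≡ true → lookup rs (suc zero) ≡ true →
          lookup rs (suc (suc zero)) ≡ true → ¬ PSD (assocMatrix G3 (lookup rs))
G3-¬PSD rs@(true ∷ true ∷ true ∷ []) refl refl refl =
  ¬PSD-witness G3 rs (+ 1 ∷ - + 1 ∷ + 1 ∷ [])

-- 4 d(a) + d(c) − 12
G4-¬PSD : ∀ rs → lookup rs (suc zero) ≡ false →
          ¬ PSD (assocMatrix G4 (lookup rs))
G4-¬PSD rs@(true  ∷ false ∷ true  ∷ []) refl = ¬PSD-witness G4 rs (+ 2 ∷ - + 2 ∷ + 1 ∷ [])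
G4-¬PSD rs@(true  ∷ false ∷ false ∷ []) refl = ¬PSD-witness G4 rs (+ 2 ∷ - + 2 ∷ + 1 ∷ [])
G4-¬PSD rs@(false ∷ false ∷ true  ∷ []) refl = ¬PSD-witness G4 rs (+ 2 ∷ - + 2 ∷ + 1 ∷ [])
G4-¬PSD rs@(false ∷ false ∷ false ∷ []) refl = ¬PSD-witness G4 rs (+ 2 ∷ - + 2 ∷ + 1 ∷ [])

-- d(a) + 4 d(b) + d(c) − 14
G5-¬PSD : ∀ rs → ¬ PSD (assocMatrix G5 (lookup rs))
G5-¬PSD rs@(true  ∷ true  ∷ true  ∷ []) = ¬PSD-witness G5 rs (+ 1 ∷ - + 2 ∷ + 1 ∷ [])
G5-¬PSD rs@(true  ∷ true  ∷ false ∷ []) = ¬PSD-witness G5 rs (+ 1 ∷ - + 2 ∷ + 1 ∷ [])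
G5-¬PSD rs@(true  ∷ false ∷ true  ∷ []) = ¬PSD-witness G5 rs (+ 1 ∷ - + 2 ∷ + 1 ∷ [])
G5-¬PSD rs@(true  ∷ false ∷ false ∷ []) = ¬PSD-witness G5 rs (+ 1 ∷ - + 2 ∷ + 1 ∷ [])
G5-¬PSD rs@(false ∷ true  ∷ true  ∷ []) = ¬PSD-witness G5 rs (+ 1 ∷ - + 2 ∷ + 1 ∷ [])
G5-¬PSD rs@(false ∷ true  ∷ false ∷ []) = ¬PSD-witness G5 rs (+ 1 ∷ - + 2 ∷ + 1 ∷ [])
G5-¬PSD rs@(false ∷ false ∷ true  ∷ []) = ¬PSD-witness G5 rs (+ 1 ∷ - + 2 ∷ + 1 ∷ [])
G5-¬PSD rs@(false ∷ false ∷ false ∷ []) = ¬PSD-witness G5 rs (+ 1 ∷ - + 2 ∷ + 1 ∷ [])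

-- 4 d(a) + d(d) − 11
G6-¬PSD : ∀ rs → lookup rs b₄ ≡ true → lookup rs c₄ ≡ false →
          ¬ PSD (assocMatrix G6 (lookup rs))
G6-¬PSD rs@(true  ∷ true ∷ false ∷ true  ∷ []) refl refl = ¬PSD-witness G6 rs (- + 2 ∷ + 3 ∷ - + 2 ∷ + 1 ∷ [])
G6-¬PSD rs@(true  ∷ true ∷ false ∷ false ∷ []) refl refl = ¬PSD-witness G6 rs (- + 2 ∷ + 3 ∷ - + 2 ∷ + 1 ∷ [])
G6-¬PSD rs@(false ∷ true ∷ false ∷ true  ∷ []) refl refl = ¬PSD-witness G6 rs (- + 2 ∷ + 3 ∷ - + 2 ∷ + 1 ∷ [])
G6-¬PSD rs@(false ∷ true ∷ false ∷ false ∷ []) refl refl = ¬PSD-witness G6 rs (- + 2 ∷ + 3 ∷ - + 2 ∷ + 1 ∷ [])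

-- d(a) − 3
G7-¬PSD : ∀ rs → lookup rs b₄ ≡ true → lookup rs c₄ ≡ false →
          lookup rs d₄ ≡ false → ¬ PSD (assocMatrix G7 (lookup rs))
G7-¬PSD rs@(true  ∷ true ∷ false ∷ false ∷ []) refl refl refl = ¬PSD-witness G7 rs (+ 1 ∷ - + 1 ∷ + 1 ∷ - + 1 ∷ [])
G7-¬PSD rs@(false ∷ true ∷ false ∷ false ∷ []) refl refl refl = ¬PSD-witness G7 rs (+ 1 ∷ - + 1 ∷ + 1 ∷ - + 1 ∷ [])

proposition2p7 :
    -- (1) u = 0 root, v = 1 arbitrary
    (∀ (R : Roots 2) → R zero ≡ true → ¬ PSD (assocMatrix G1 R))
    -- (2) both non-roots
    × (∀ (R : Roots 2) → R zero ≡ false → R (suc zero) ≡ false →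
         ¬ PSD (assocMatrix G2 R))
    -- (3) all three roots
    × (∀ (R : Roots 3) → R zero ≡ true → R (suc zero) ≡ true →
         R (suc (suc zero)) ≡ true → ¬ PSD (assocMatrix G3 R))
    -- (4) b non-root, a, c arbitrary
    × (∀ (R : Roots 3) → R (suc zero) ≡ false → ¬ PSD (assocMatrix G4 R))
    -- (5) a, b, c arbitrary
    × (∀ (R : Roots 3) → ¬ PSD (assocMatrix G5 R))
    -- (6) b root, c non-root, a, d arbitrary
    × (∀ (R : Roots 4) → R b₄ ≡ true → R c₄ ≡ false →
         ¬ PSD (assocMatrix G6 R))
    -- (7) b root, c, d non-roots, a arbitrary
    × (∀ (R : Roots 4) → R b₄ ≡ true → R c₄ ≡ false → R d₄ ≡ false →
         ¬ PSD (assocMatrix G7 R))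
proposition2p7 =
    (λ R u → G1-¬PSD (tabulate R) u ∘ PSD-tabulate G1 R)
  , (λ R u v → G2-¬PSD (tabulate R) u v ∘ PSD-tabulate G2 R)
  , (λ R u v w → G3-¬PSD (tabulate R) u v w ∘ PSD-tabulate G3 R)
  , (λ R b → G4-¬PSD (tabulate R) b ∘ PSD-tabulate G4 R)
  , (λ R → G5-¬PSD (tabulate R) ∘ PSD-tabulate G5 R)
  , (λ R b c → G6-¬PSD (tabulate R) b c ∘ PSD-tabulate G6 R)
  , (λ R b c d → G7-¬PSD (tabulate R) b c d ∘ PSD-tabulate G7 R)
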